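{- Let $\mathbb{F}_q$ be a finite field of characteristic $p \neq 2$, let $f(x) \in \mathbb{F}_q[x]$ be an irreducible polynomial of degree $d$, and let $N : y^2 = x f(x)^2$. Let $h(x) \in \mathbb{F}_q[x]$ be a polynomial of degree less than $d$ such that $\gcd(f(x), x - h(x)^2) = 1$. Then the pair $D = [f(x)^2,\, h(x) f(x)]$ represents an element of $\mathrm{Jac}(N)$.
   Context: $\mathrm{Jac}(N)$ denotes the (generalized) Jacobian of $N$, i.e. the ideal class group of the coordinate ring $\mathbb{F}_q[x,y]/(y^2 - x f(x)^2)$. Divisor classes on a curve $y^2 = F(x)$ are described by the extended Mumford representation: a pair of polynomials $[u(x), v(x)]$ represents a divisor class (the class of the ideal $(u(x), y - v(x))$) if (i) $\deg v < \deg u$; (ii) $u(x)$ divides $v(x)^2 - F(x)$; (iii) whenever $u(x)$ and $v(x)$ are both divisible by $x-a$ for a multiple root $a$ of $F(x)$, the polynomial $(F(x) - v(x)^2)/u(x)$ is not divisible by $x-a$. -}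

module Defs where

open import Level using (Level; _⊔_) renaming (suc to lsuc)
open import Data.Nat using (ℕ; zero; suc; _<_)
open import Data.Product using (Σ; ∃; _×_)
open import Data.Sum using (_⊎_)
open import Data.List using (List; []; _∷_; map)
open import Data.List.Relation.Unary.All using (All)
open import Data.List.Relation.Unary.Any using (Any)
open import Relation.Nullary using (¬_; yes; no)
open import Relation.Binary.Definitions using (Decidable)
open import Algebra.Bundles using (CommutativeRing)

record FiniteField (c ℓ : Level) : Set (lsuc (c ⊔ ℓ)) where
  field
    commRing : CommutativeRing c ℓ
  open CommutativeRing commRing public
  field
    _≟_       : Decidable _≈_
    1≉0       : ¬ (1# ≈ 0#)
    inverse   : ∀ x → ¬ (x ≈ 0#) → ∃ λ y → x * y ≈ 1#
    elements  : List Carrier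
    complete  : ∀ x → Any (x ≈_) elements

-- Univariate polynomials over 𝔽, as coefficient lists (constant term first).
module Poly {c ℓ : Level} (𝔽 : FiniteField c ℓ) where
  open FiniteField 𝔽

  Pol : Set c
  Pol = List Carrier

  infixl 6 _+P_ _-P_
  infixl 7 _*P_
  infix 4 _≈P_

  _+P_ : Pol → Pol → Pol
  []      +P q       = q
  (a ∷ p) +P []      = a ∷ p
  (a ∷ p) +P (b ∷ q) = (a + b) ∷ (p +P q)

  -P_ : Pol → Pol
  -P p = map -_ p

  _-P_ : Pol → Pol → Pol
  p -P q = p +P (-P q)

  _*P_ : Pol → Pol → Pol
  []      *P q = []
  (a ∷ p) *P q = map (a *_) q +P (0# ∷ (p *P q))

  oneP : Pol
  oneP = 1# ∷ []

  X : Pol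
  X = 0# ∷ 1# ∷ []

  IsZeroP : Pol → Set (c ⊔ ℓ)
  IsZeroP p = All (_≈ 0#) p

  -- equality of polynomials (coefficientwise, ignoring trailing zeros)
  _≈P_ : Pol → Pol → Set (c ⊔ ℓ)
  p ≈P q = IsZeroP (p -P q)

  -- len p = deg p + 1 for p ≠ 0, and len 0 = 0  (so deg p < deg q ⇔ len p < len q,
  -- with deg 0 = -∞)
  len : Pol → ℕ
  len [] = 0
  len (a ∷ p) with len p
  ... | suc n = suc (suc n)
  ... | zero with a ≟ 0#
  ...   | yes _ = 0
  ...   | no _  = 1

  Divides : Pol → Pol → Set (c ⊔ ℓ)
  Divides p q = Σ Pol λ r → p *P r ≈P q

  Unit : Pol → Set (c ⊔ ℓ)
  Unit p = Divides p oneP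

  Irreducible : Pol → Set (c ⊔ ℓ)
  Irreducible p = ¬ IsZeroP p × ¬ Unit p
                  × (∀ g k → g *P k ≈P p → Unit g ⊎ Unit k)

  Coprime : Pol → Pol → Set (c ⊔ ℓ)
  Coprime p q = ∀ g → Divides g p → Divides g q → Unit g

  -- [u, v] is an (extended) Mumford representation of a divisor class on y² = F.
  -- Condition (iii) is stated with irreducible factors P of F of multiplicity ≥ 2
  -- (over the perfect field 𝔽_q these correspond to Galois orbits of multiple roots a).
  MumfordRep : Pol → Pol → Pol → Set (c ⊔ ℓ)
  MumfordRep F u v =
      (len v < len u)
    × Divides u (v *P v -P F)
    × (∀ w → u *P w ≈P F -P v *P v →
         ∀ P → Irreducible P → Divides (P *P P) F →
         Divides P u → Divides P v → ¬ Divides P w)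

{-# OPTIONS --safe #-}
-- Conditions (i) and (ii) come from degree counting and the identity
-- f² (x − h²) = x f² − (h f)².  For (iii), cancelling the nonzero f² in
-- f² w = x f² − (h f)² gives w = x − h².  An irreducible P dividing f² and w
-- then divides f, since a Bézout identity s f + t (x − h²) = 1 gives
-- f = s f² + t f (x − h²); so P is a common factor of f and x − h², hence a unit.
module Submission where

open import Level using (Level; _⊔_)
open import Data.Nat using (ℕ; zero; suc; _≤_; _<_; z≤n; s≤s)
import Data.Nat as ℕ
import Data.Nat.Properties as ℕ
open import Data.Product using (∃; ∃₂; _×_; _,_; proj₁; proj₂)
open import Data.Sum using (_⊎_; inj₁; inj₂)
open import Data.List using ([]; _∷_; map)
open import Data.List.Relation.Unary.All using ([]; _∷_)
open import Relation.Nullary using (¬_; yes; no; contradiction)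
open import Relation.Binary.Structures using (IsEquivalence)
open import Relation.Binary.PropositionalEquality as ≡ using (_≡_)
open import Algebra.Bundles using (AbelianGroup; CommutativeRing)
import Algebra.Properties.CommutativeSemigroup as CommutativeSemigroupProperties
import Algebra.Properties.CommutativeSemigroup.Divisibility as Divisibility
import Algebra.Properties.Ring as RingProperties
import Relation.Binary.Reasoning.Setoid as SetoidReasoning

open import Defs

module PolynomialArithmetic {c ℓ : Level} (𝔽 : FiniteField c ℓ) where
  open FiniteField 𝔽
  open Poly 𝔽
  open RingProperties ring using (-0#≈0#)

  module ≈-Reasoning = SetoidReasoning setoid

  -- Coefficientwise equality and the ring 𝔽[X]

  coef : Pol → ℕ → Carrier
  coef []      _       = 0#
  coef (a ∷ p) zero    = a
  coef (a ∷ p) (suc n) = coef p n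

  -- Equivalent to _≈P_ (see ≈P⇒≃ and ≃⇒≈P), but every ring law becomes a
  -- pointwise consequence of the corresponding law in 𝔽.
  infix 4 _≃_
  record _≃_ (p q : Pol) : Set ℓ where
    constructor mk≃
    field coef-≈ : ∀ n → coef p n ≈ coef q n
  open _≃_

  ≃-refl : ∀ {p} → p ≃ p
  ≃-refl = mk≃ λ _ → refl

  ≃-sym : ∀ {p q} → p ≃ q → q ≃ p
  ≃-sym p≃q = mk≃ λ n → sym (coef-≈ p≃q n)

  ≃-trans : ∀ {p q r} → p ≃ q → q ≃ r → p ≃ r
  ≃-trans p≃q q≃r = mk≃ λ n → trans (coef-≈ p≃q n) (coef-≈ q≃r n)

  ≃-isEquivalence : IsEquivalence _≃_
  ≃-isEquivalence = record { refl = ≃-refl ; sym = ≃-sym ; trans = ≃-trans }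

  ∷-cong : ∀ {a b p q} → a ≈ b → p ≃ q → a ∷ p ≃ b ∷ q
  ∷-cong a≈b p≃q = mk≃ λ { zero → a≈b ; (suc n) → coef-≈ p≃q n }

  ∷-≃[] : ∀ {a p} → a ≈ 0# → p ≃ [] → a ∷ p ≃ []
  ∷-≃[] a≈0 p≃[] = mk≃ λ { zero → a≈0 ; (suc n) → coef-≈ p≃[] n }

  ∷-injectiveʳ : ∀ {a b p q} → a ∷ p ≃ b ∷ q → p ≃ q
  ∷-injectiveʳ a∷p≃b∷q = mk≃ λ n → coef-≈ a∷p≃b∷q (suc n)

  ∷-≃[]⁻¹ : ∀ {a p} → a ∷ p ≃ [] → a ≈ 0# × p ≃ []
  ∷-≃[]⁻¹ a∷p≃[] = coef-≈ a∷p≃[] 0 , mk≃ λ n → coef-≈ a∷p≃[] (suc n)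

  coef-+P : ∀ p q n → coef (p +P q) n ≈ coef p n + coef q n
  coef-+P []      q       n       = sym (+-identityˡ _)
  coef-+P (a ∷ p) []      n       = sym (+-identityʳ _)
  coef-+P (a ∷ p) (b ∷ q) zero    = refl
  coef-+P (a ∷ p) (b ∷ q) (suc n) = coef-+P p q n

  coef--P : ∀ p n → coef (-P p) n ≈ - coef p n
  coef--P []      n       = sym -0#≈0#
  coef--P (a ∷ p) zero    = refl
  coef--P (a ∷ p) (suc n) = coef--P p n

  coef-scale : ∀ a p n → coef (map (a *_) p) n ≈ a * coef p n
  coef-scale a []      n       = sym (zeroʳ a)
  coef-scale a (b ∷ p) zero    = refl
  coef-scale a (b ∷ p) (suc n) = coef-scale a p n

  module _ where
    open ≈-Reasoning

    +P-cong : ∀ {p p′ q q′} → p ≃ p′ → q ≃ q′ → p +P q ≃ p′ +P q′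
    +P-cong {p} {p′} {q} {q′} p≃p′ q≃q′ = mk≃ λ n → begin
      coef (p +P q) n        ≈⟨ coef-+P p q n ⟩
      coef p n + coef q n    ≈⟨ +-cong (coef-≈ p≃p′ n) (coef-≈ q≃q′ n) ⟩
      coef p′ n + coef q′ n  ≈⟨ coef-+P p′ q′ n ⟨
      coef (p′ +P q′) n      ∎

    +P-assoc : ∀ p q r → (p +P q) +P r ≃ p +P (q +P r)
    +P-assoc p q r = mk≃ λ n → begin
      coef ((p +P q) +P r) n              ≈⟨ coef-+P (p +P q) r n ⟩
      coef (p +P q) n + coef r n          ≈⟨ +-congʳ (coef-+P p q n) ⟩
      (coef p n + coef q n) + coef r n    ≈⟨ +-assoc _ _ _ ⟩
      coef p n + (coef q n + coef r n)    ≈⟨ +-congˡ (coef-+P q r n) ⟨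
      coef p n + coef (q +P r) n          ≈⟨ coef-+P p (q +P r) n ⟨
      coef (p +P (q +P r)) n              ∎

    +P-comm : ∀ p q → p +P q ≃ q +P p
    +P-comm p q = mk≃ λ n → begin
      coef (p +P q) n      ≈⟨ coef-+P p q n ⟩
      coef p n + coef q n  ≈⟨ +-comm _ _ ⟩
      coef q n + coef p n  ≈⟨ coef-+P q p n ⟨
      coef (q +P p) n      ∎

    +P-identityʳ : ∀ p → p +P [] ≃ p
    +P-identityʳ p = mk≃ λ n → trans (coef-+P p [] n) (+-identityʳ _)

    -P-cong : ∀ {p q} → p ≃ q → -P p ≃ -P q
    -P-cong {p} {q} p≃q = mk≃ λ n → begin
      coef (-P p) n  ≈⟨ coef--P p n ⟩
      - coef p n     ≈⟨ -‿cong (coef-≈ p≃q n) ⟩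
      - coef q n     ≈⟨ coef--P q n ⟨
      coef (-P q) n  ∎

    -P-inverseʳ : ∀ p → p -P p ≃ []
    -P-inverseʳ p = mk≃ λ n → begin
      coef (p -P p) n           ≈⟨ coef-+P p (-P p) n ⟩
      coef p n + coef (-P p) n  ≈⟨ +-congˡ (coef--P p n) ⟩
      coef p n + - coef p n     ≈⟨ -‿inverseʳ _ ⟩
      0#                        ∎

  +P-abelianGroup : AbelianGroup c ℓ
  +P-abelianGroup = record
    { Carrier = Pol ; _≈_ = _≃_ ; _∙_ = _+P_ ; ε = [] ; _⁻¹ = -P_
    ; isAbelianGroup = record
      { isGroup = record
        { isMonoid = record
          { isSemigroup = record
            { isMagma = record { isEquivalence = ≃-isEquivalence ; ∙-cong = +P-cong }
            ; assoc = +P-assoc }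
          ; identity = (λ _ → ≃-refl) , +P-identityʳ }
        ; inverse = (λ p → ≃-trans (+P-comm (-P p) p) (-P-inverseʳ p)) , -P-inverseʳ
        ; ⁻¹-cong = -P-cong }
      ; comm = +P-comm } }

  open CommutativeSemigroupProperties (AbelianGroup.commutativeSemigroup +P-abelianGroup)
    using () renaming (interchange to +P-interchange; x∙yz≈y∙xz to +P-leftComm)

  module ≃-Reasoning = SetoidReasoning (AbelianGroup.setoid +P-abelianGroup)

  module _ where
    open ≈-Reasoning

    scale-cong : ∀ {a b p q} → a ≈ b → p ≃ q → map (a *_) p ≃ map (b *_) q
    scale-cong {a} {b} {p} {q} a≈b p≃q = mk≃ λ n → begin
      coef (map (a *_) p) n  ≈⟨ coef-scale a p n ⟩
      a * coef p n           ≈⟨ *-cong a≈b (coef-≈ p≃q n) ⟩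
      b * coef q n           ≈⟨ coef-scale b q n ⟨
      coef (map (b *_) q) n  ∎

    scale-zero : ∀ {a} p → a ≈ 0# → map (a *_) p ≃ []
    scale-zero {a} p a≈0 = mk≃ λ n → begin
      coef (map (a *_) p) n  ≈⟨ coef-scale a p n ⟩
      a * coef p n           ≈⟨ *-congʳ a≈0 ⟩
      0# * coef p n          ≈⟨ zeroˡ _ ⟩
      0#                     ∎

    scale-one : ∀ p → map (1# *_) p ≃ p
    scale-one p = mk≃ λ n → trans (coef-scale 1# p n) (*-identityˡ _)

    scale-+P : ∀ a p q → map (a *_) (p +P q) ≃ map (a *_) p +P map (a *_) q
    scale-+P a p q = mk≃ λ n → begin
      coef (map (a *_) (p +P q)) n                      ≈⟨ coef-scale a (p +P q) n ⟩
      a * coef (p +P q) n                               ≈⟨ *-congˡ (coef-+P p q n) ⟩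
      a * (coef p n + coef q n)                         ≈⟨ distribˡ _ _ _ ⟩
      a * coef p n + a * coef q n                       ≈⟨ +-cong (coef-scale a p n) (coef-scale a q n) ⟨
      coef (map (a *_) p) n + coef (map (a *_) q) n     ≈⟨ coef-+P (map (a *_) p) (map (a *_) q) n ⟨
      coef (map (a *_) p +P map (a *_) q) n             ∎

    +-scale : ∀ a b p → map ((a + b) *_) p ≃ map (a *_) p +P map (b *_) p
    +-scale a b p = mk≃ λ n → begin
      coef (map ((a + b) *_) p) n                       ≈⟨ coef-scale (a + b) p n ⟩
      (a + b) * coef p n                                ≈⟨ distribʳ _ _ _ ⟩
      a * coef p n + b * coef p n                       ≈⟨ +-cong (coef-scale a p n) (coef-scale b p n) ⟨
      coef (map (a *_) p) n + coef (map (b *_) p) n     ≈⟨ coef-+P (map (a *_) p) (map (b *_) p) n ⟨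
      coef (map (a *_) p +P map (b *_) p) n             ∎

    scale-scale : ∀ a b p → map (a *_) (map (b *_) p) ≃ map ((a * b) *_) p
    scale-scale a b p = mk≃ λ n → begin
      coef (map (a *_) (map (b *_) p)) n  ≈⟨ coef-scale a (map (b *_) p) n ⟩
      a * coef (map (b *_) p) n           ≈⟨ *-congˡ (coef-scale b p n) ⟩
      a * (b * coef p n)                  ≈⟨ *-assoc _ _ _ ⟨
      (a * b) * coef p n                  ≈⟨ coef-scale (a * b) p n ⟨
      coef (map ((a * b) *_) p) n         ∎

  *P-zeroʳ : ∀ p → p *P [] ≃ []
  *P-zeroʳ []      = ≃-refl
  *P-zeroʳ (a ∷ p) = ∷-≃[] refl (*P-zeroʳ p)

  *P-zeroˡ : ∀ {p} q → p ≃ [] → p *P q ≃ []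
  *P-zeroˡ {[]}    q _      = ≃-refl
  *P-zeroˡ {a ∷ p} q a∷p≃[] with ∷-≃[]⁻¹ a∷p≃[]
  ... | a≈0 , p≃[] = +P-cong (scale-zero q a≈0) (∷-≃[] refl (*P-zeroˡ q p≃[]))

  *P-∷ʳ : ∀ p b q → p *P (b ∷ q) ≃ map (b *_) p +P (0# ∷ p *P q)
  *P-∷ʳ []      b q = ≃-sym (∷-≃[] refl ≃-refl)
  *P-∷ʳ (a ∷ p) b q = ∷-cong (+-congʳ (*-comm a b)) (begin
    map (a *_) q +P p *P (b ∷ q)
      ≈⟨ +P-cong ≃-refl (*P-∷ʳ p b q) ⟩
    map (a *_) q +P (map (b *_) p +P (0# ∷ p *P q))
      ≈⟨ +P-leftComm (map (a *_) q) (map (b *_) p) (0# ∷ p *P q) ⟩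
    map (b *_) p +P (map (a *_) q +P (0# ∷ p *P q))
      ∎)
    where open ≃-Reasoning

  *P-comm : ∀ p q → p *P q ≃ q *P p
  *P-comm []      q = ≃-sym (*P-zeroʳ q)
  *P-comm (a ∷ p) q = ≃-trans (+P-cong ≃-refl (∷-cong refl (*P-comm p q))) (≃-sym (*P-∷ʳ q a p))

  *P-congˡ : ∀ {p p′} q → p ≃ p′ → p *P q ≃ p′ *P q
  *P-congˡ {[]}    {p′}      q p≃p′ = ≃-sym (*P-zeroˡ q (≃-sym p≃p′))
  *P-congˡ {a ∷ p} {[]}      q p≃p′ = *P-zeroˡ q p≃p′
  *P-congˡ {a ∷ p} {a′ ∷ p′} q p≃p′ =
    +P-cong (scale-cong (coef-≈ p≃p′ 0) ≃-refl) (∷-cong refl (*P-congˡ q (∷-injectiveʳ p≃p′)))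

  *P-congʳ : ∀ p {q q′} → q ≃ q′ → p *P q ≃ p *P q′
  *P-congʳ p {q} {q′} q≃q′ = ≃-trans (*P-comm p q) (≃-trans (*P-congˡ p q≃q′) (*P-comm q′ p))

  *P-distribʳ : ∀ q p p′ → (p +P p′) *P q ≃ p *P q +P p′ *P q
  *P-distribʳ q []      p′        = ≃-refl
  *P-distribʳ q (a ∷ p) []        = ≃-sym (+P-identityʳ _)
  *P-distribʳ q (a ∷ p) (a′ ∷ p′) = begin
    map ((a + a′) *_) q +P (0# ∷ (p +P p′) *P q)
      ≈⟨ +P-cong (+-scale a a′ q) (∷-cong (sym (+-identityʳ 0#)) (*P-distribʳ q p p′)) ⟩
    (map (a *_) q +P map (a′ *_) q) +P ((0# ∷ p *P q) +P (0# ∷ p′ *P q))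
      ≈⟨ +P-interchange (map (a *_) q) (map (a′ *_) q) (0# ∷ p *P q) (0# ∷ p′ *P q) ⟩
    (map (a *_) q +P (0# ∷ p *P q)) +P (map (a′ *_) q +P (0# ∷ p′ *P q))
      ∎
    where open ≃-Reasoning

  *P-distribˡ : ∀ p q q′ → p *P (q +P q′) ≃ p *P q +P p *P q′
  *P-distribˡ p q q′ = ≃-trans (*P-comm p (q +P q′))
    (≃-trans (*P-distribʳ p q q′) (+P-cong (*P-comm q p) (*P-comm q′ p)))

  scale-*P : ∀ a p q → map (a *_) (p *P q) ≃ map (a *_) p *P q
  scale-*P a []      q = ≃-refl
  scale-*P a (b ∷ p) q = begin
    map (a *_) (map (b *_) q +P (0# ∷ p *P q))
      ≈⟨ scale-+P a (map (b *_) q) (0# ∷ p *P q) ⟩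
    map (a *_) (map (b *_) q) +P (a * 0# ∷ map (a *_) (p *P q))
      ≈⟨ +P-cong (scale-scale a b q) (∷-cong (zeroʳ a) (scale-*P a p q)) ⟩
    map ((a * b) *_) q +P (0# ∷ map (a *_) p *P q)
      ∎
    where open ≃-Reasoning

  0∷-*P : ∀ p q → (0# ∷ p) *P q ≃ 0# ∷ p *P q
  0∷-*P p q = +P-cong (scale-zero q refl) ≃-refl

  *P-assoc : ∀ p q r → (p *P q) *P r ≃ p *P (q *P r)
  *P-assoc []      q r = ≃-refl
  *P-assoc (a ∷ p) q r = begin
    (map (a *_) q +P (0# ∷ p *P q)) *P r         ≈⟨ *P-distribʳ r (map (a *_) q) (0# ∷ p *P q) ⟩
    map (a *_) q *P r +P (0# ∷ p *P q) *P r      ≈⟨ +P-cong (≃-sym (scale-*P a q r)) (0∷-*P (p *P q) r) ⟩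
    map (a *_) (q *P r) +P (0# ∷ (p *P q) *P r)  ≈⟨ +P-cong ≃-refl (∷-cong refl (*P-assoc p q r)) ⟩
    map (a *_) (q *P r) +P (0# ∷ p *P (q *P r))  ∎
    where open ≃-Reasoning

  *P-identityˡ : ∀ p → oneP *P p ≃ p
  *P-identityˡ p = ≃-trans (+P-cong (scale-one p) (∷-≃[] refl ≃-refl)) (+P-identityʳ p)

  𝔽[X] : CommutativeRing c ℓ
  𝔽[X] = record
    { Carrier = Pol ; _≈_ = _≃_ ; _+_ = _+P_ ; _*_ = _*P_ ; -_ = -P_ ; 0# = [] ; 1# = oneP
    ; isCommutativeRing = record
      { isRing = record
        { +-isAbelianGroup = AbelianGroup.isAbelianGroup +P-abelianGroup
        ; *-cong           = λ {p} {p′} {q} p≃p′ q≃q′ →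
                               ≃-trans (*P-congˡ q p≃p′) (*P-congʳ p′ q≃q′)
        ; *-assoc          = *P-assoc
        ; *-identity       = *P-identityˡ , λ p → ≃-trans (*P-comm p oneP) (*P-identityˡ p)
        ; distrib          = *P-distribˡ , *P-distribʳ }
      ; *-comm = *P-comm } }

  module 𝔽[X] where
    open CommutativeRing 𝔽[X] public
    open RingProperties (CommutativeRing.ring 𝔽[X]) public

  open Divisibility 𝔽[X].*-commutativeSemigroup public using (_∣_; _,_; ∣ʳ-respʳ-≈; x∣ʳy⇒x∣ʳzy)
  open CommutativeSemigroupProperties 𝔽[X].*-commutativeSemigroup using () renaming (interchange to *P-interchange)

  IsZeroP⇒≃[] : ∀ {p} → IsZeroP p → p ≃ []
  IsZeroP⇒≃[] []            = ≃-refl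
  IsZeroP⇒≃[] (a≈0 ∷ p≈0) = ∷-≃[] a≈0 (IsZeroP⇒≃[] p≈0)

  ≃[]⇒IsZeroP : ∀ {p} → p ≃ [] → IsZeroP p
  ≃[]⇒IsZeroP {[]}    _      = []
  ≃[]⇒IsZeroP {a ∷ p} a∷p≃[] with ∷-≃[]⁻¹ a∷p≃[]
  ... | a≈0 , p≃[] = a≈0 ∷ ≃[]⇒IsZeroP p≃[]

  ≈P⇒≃ : ∀ {p q} → p ≈P q → p ≃ q
  ≈P⇒≃ {p} {q} p-q≈0 = 𝔽[X].x∙y⁻¹≈ε⇒x≈y p q (IsZeroP⇒≃[] p-q≈0)

  ≃⇒≈P : ∀ {p q} → p ≃ q → p ≈P q
  ≃⇒≈P p≃q = ≃[]⇒IsZeroP (𝔽[X].x≈y⇒x∙y⁻¹≈ε p≃q)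

  Divides⇒∣ : ∀ {p q} → Divides p q → p ∣ q
  Divides⇒∣ {p} (r , pr≈q) = r , ≃-trans (*P-comm r p) (≈P⇒≃ pr≈q)

  ∣⇒Divides : ∀ {p q} → p ∣ q → Divides p q
  ∣⇒Divides {p} (r , rp≃q) = r , ≃⇒≈P (≃-trans (*P-comm p r) rp≃q)

  ∣-+P : ∀ {p q r} → p ∣ q → p ∣ r → p ∣ q +P r
  ∣-+P {p} (q′ , q′p≃q) (r′ , r′p≃r) =
    q′ +P r′ , ≃-trans (*P-distribʳ p q′ r′) (+P-cong q′p≃q r′p≃r)

  -- Degrees

  record DegreeBelow (n : ℕ) (p : Pol) : Set ℓ where
    constructor degreeBelow
    field coef-vanishes : ∀ k → n ≤ k → coef p k ≈ 0#
  open DegreeBelow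

  HasDegree : ℕ → Pol → Set ℓ
  HasDegree m p = DegreeBelow (suc m) p × ¬ coef p m ≈ 0#

  degreeBelow-[] : ∀ {n} → DegreeBelow n []
  degreeBelow-[] = degreeBelow λ _ _ → refl

  degreeBelow-zero : ∀ {p} → DegreeBelow 0 p → p ≃ []
  degreeBelow-zero p<0 = mk≃ λ k → coef-vanishes p<0 k z≤n

  degreeBelow-mono : ∀ {m n p} → m ≤ n → DegreeBelow m p → DegreeBelow n p
  degreeBelow-mono m≤n p<m = degreeBelow λ k n≤k → coef-vanishes p<m k (ℕ.≤-trans m≤n n≤k)

  degreeBelow-resp : ∀ {n p q} → p ≃ q → DegreeBelow n p → DegreeBelow n q
  degreeBelow-resp p≃q p<n = degreeBelow λ k n≤k → trans (sym (coef-≈ p≃q k)) (coef-vanishes p<n k n≤k)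

  degreeBelow-pred : ∀ {m p} → DegreeBelow (suc m) p → coef p m ≈ 0# → DegreeBelow m p
  degreeBelow-pred {m} {p} p<1+m pₘ≈0 = degreeBelow λ k m≤k → case (ℕ.m≤n⇒m<n∨m≡n m≤k)
    where
    case : ∀ {k} → m < k ⊎ m ≡ k → coef p k ≈ 0#
    case (inj₁ m<k)     = coef-vanishes p<1+m _ m<k
    case (inj₂ ≡.refl) = pₘ≈0

  degreeBelow-∷ : ∀ {n p} a → DegreeBelow n p → DegreeBelow (suc n) (a ∷ p)
  degreeBelow-∷ a p<n = degreeBelow λ { zero () ; (suc k) (s≤s n≤k) → coef-vanishes p<n k n≤k }

  degreeBelow-tail : ∀ {n a p} → DegreeBelow (suc n) (a ∷ p) → DegreeBelow n p
  degreeBelow-tail a∷p<1+n = degreeBelow λ k n≤k → coef-vanishes a∷p<1+n (suc k) (s≤s n≤k)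

  degreeBelow-+P : ∀ {n p q} → DegreeBelow n p → DegreeBelow n q → DegreeBelow n (p +P q)
  degreeBelow-+P {p = p} {q} p<n q<n = degreeBelow λ k n≤k →
    trans (coef-+P p q k) (trans (+-cong (coef-vanishes p<n k n≤k) (coef-vanishes q<n k n≤k)) (+-identityˡ 0#))

  degreeBelow--P : ∀ {n p} → DegreeBelow n p → DegreeBelow n (-P p)
  degreeBelow--P {p = p} p<n = degreeBelow λ k n≤k →
    trans (coef--P p k) (trans (-‿cong (coef-vanishes p<n k n≤k)) -0#≈0#)

  degreeBelow-scale : ∀ {n p} a → DegreeBelow n p → DegreeBelow n (map (a *_) p)
  degreeBelow-scale {p = p} a p<n = degreeBelow λ k n≤k →
    trans (coef-scale a p k) (trans (*-congˡ (coef-vanishes p<n k n≤k)) (zeroʳ a))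

  degreeBelow-len : ∀ p → DegreeBelow (len p) p
  degreeBelow-len []      = degreeBelow-[]
  degreeBelow-len (a ∷ p) with len p | degreeBelow-len p
  ... | suc n | p<1+n = degreeBelow-∷ a p<1+n
  ... | zero  | p<0 with a ≟ 0#
  ...   | yes a≈0 = degreeBelow λ { zero _ → a≈0 ; (suc k) _ → coef-vanishes p<0 k z≤n }
  ...   | no  _   = degreeBelow-∷ a p<0

  len≡suc⇒coef≉0 : ∀ p {m} → len p ≡ suc m → ¬ coef p m ≈ 0#
  len≡suc⇒coef≉0 (a ∷ p) {m} len≡ with len p in len-p≡
  ... | suc n with ≡.refl ← len≡ = len≡suc⇒coef≉0 p len-p≡
  ... | zero with a ≟ 0#
  ...   | no a≉0 with ≡.refl ← len≡ = a≉0

  degreeBelow⇒len≤ : ∀ {n} p → DegreeBelow n p → len p ≤ n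
  degreeBelow⇒len≤ {n} p p<n with len p in len-p≡
  ... | zero  = z≤n
  ... | suc m with suc m ℕ.≤? n
  ...   | yes 1+m≤n = 1+m≤n
  ...   | no  1+m≰n =
    contradiction (coef-vanishes p<n m (ℕ.≤-pred (ℕ.≰⇒> 1+m≰n))) (len≡suc⇒coef≉0 p len-p≡)

  len≤⇒degreeBelow : ∀ {n} p → len p ≤ n → DegreeBelow n p
  len≤⇒degreeBelow p len≤n = degreeBelow-mono len≤n (degreeBelow-len p)

  coef≉0⇒<len : ∀ {p m} → ¬ coef p m ≈ 0# → m < len p
  coef≉0⇒<len {p} {m} pₘ≉0 with m ℕ.<? len p
  ... | yes m<len = m<len
  ... | no  m≮len = contradiction (coef-vanishes (degreeBelow-len p) m (ℕ.≮⇒≥ m≮len)) pₘ≉0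

  len≡suc⇒hasDegree : ∀ {p m} → len p ≡ suc m → HasDegree m p
  len≡suc⇒hasDegree {p} len-p≡ =
    ≡.subst (λ n → DegreeBelow n p) len-p≡ (degreeBelow-len p) , len≡suc⇒coef≉0 p len-p≡

  ≃[]⊎hasDegree : ∀ p → p ≃ [] ⊎ ∃ λ m → HasDegree m p
  ≃[]⊎hasDegree p with len p in len-p≡
  ... | zero  = inj₁ (degreeBelow-zero (≡.subst (λ n → DegreeBelow n p) len-p≡ (degreeBelow-len p)))
  ... | suc m = inj₂ (m , len≡suc⇒hasDegree len-p≡)

  degreeBelow-*P : ∀ {m n p q} → DegreeBelow m p → DegreeBelow (suc n) q → DegreeBelow (m ℕ.+ n) (p *P q)
  degreeBelow-*P {p = []} _ _ = degreeBelow-[]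
  degreeBelow-*P {zero} {p = a ∷ p} {q} a∷p<0 _ =
    degreeBelow-resp (≃-sym (*P-zeroˡ q (degreeBelow-zero a∷p<0))) degreeBelow-[]
  degreeBelow-*P {suc m} {n} {a ∷ p} a∷p<1+m q<1+n = degreeBelow-+P
    (degreeBelow-scale a (degreeBelow-mono (s≤s (ℕ.m≤n+m n m)) q<1+n))
    (degreeBelow-∷ 0# (degreeBelow-*P (degreeBelow-tail a∷p<1+m) q<1+n))

  coef-*P-top : ∀ {m n p q} → DegreeBelow (suc m) p → DegreeBelow (suc n) q →
                coef (p *P q) (m ℕ.+ n) ≈ coef p m * coef q n
  coef-*P-top {p = []} _ _ = sym (zeroˡ _)
  coef-*P-top {zero} {n} {a ∷ p} {q} a∷p<1 _ = begin
    coef (map (a *_) q +P (0# ∷ p *P q)) n  ≈⟨ coef-≈ (+P-cong (≃-refl {map (a *_) q}) 0∷pq≃[]) n ⟩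
    coef (map (a *_) q +P []) n             ≈⟨ coef-≈ (+P-identityʳ (map (a *_) q)) n ⟩
    coef (map (a *_) q) n                   ≈⟨ coef-scale a q n ⟩
    a * coef q n                            ∎
    where
    open ≈-Reasoning
    0∷pq≃[] : 0# ∷ p *P q ≃ []
    0∷pq≃[] = ∷-≃[] refl (*P-zeroˡ q (degreeBelow-zero (degreeBelow-tail a∷p<1)))
  coef-*P-top {suc m} {n} {a ∷ p} {q} a∷p<2+m q<1+n = begin
    coef (map (a *_) q +P (0# ∷ p *P q)) (suc (m ℕ.+ n))
      ≈⟨ coef-+P (map (a *_) q) (0# ∷ p *P q) (suc (m ℕ.+ n)) ⟩
    coef (map (a *_) q) (suc (m ℕ.+ n)) + coef (p *P q) (m ℕ.+ n)
      ≈⟨ +-cong (coef-scale a q _) (coef-*P-top (degreeBelow-tail a∷p<2+m) q<1+n) ⟩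
    a * coef q (suc (m ℕ.+ n)) + coef p m * coef q n
      ≈⟨ +-congʳ (trans (*-congˡ (coef-vanishes q<1+n _ (s≤s (ℕ.m≤n+m n m)))) (zeroʳ a)) ⟩
    0# + coef p m * coef q n
      ≈⟨ +-identityˡ _ ⟩
    coef p m * coef q n
      ∎
    where open ≈-Reasoning

  x≉0∧y≉0⇒x*y≉0 : ∀ {x y} → ¬ x ≈ 0# → ¬ y ≈ 0# → ¬ x * y ≈ 0#
  x≉0∧y≉0⇒x*y≉0 {x} {y} x≉0 y≉0 xy≈0 with inverse x x≉0
  ... | x⁻¹ , xx⁻¹≈1 = y≉0 (begin
    y              ≈⟨ *-identityˡ y ⟨
    1# * y         ≈⟨ *-congʳ (trans (*-comm x⁻¹ x) xx⁻¹≈1) ⟨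
    (x⁻¹ * x) * y  ≈⟨ *-assoc x⁻¹ x y ⟩
    x⁻¹ * (x * y)  ≈⟨ *-congˡ xy≈0 ⟩
    x⁻¹ * 0#       ≈⟨ zeroʳ x⁻¹ ⟩
    0#             ∎)
    where open ≈-Reasoning

  hasDegree-*P : ∀ {m n p q} → HasDegree m p → HasDegree n q → HasDegree (m ℕ.+ n) (p *P q)
  hasDegree-*P (p<1+m , pₘ≉0) (q<1+n , qₙ≉0) =
      degreeBelow-*P p<1+m q<1+n
    , λ top≈0 → x≉0∧y≉0⇒x*y≉0 pₘ≉0 qₙ≉0 (trans (sym (coef-*P-top p<1+m q<1+n)) top≈0)

  *P-cancelˡ : ∀ {m p q r} → HasDegree m p → p *P q ≃ p *P r → q ≃ r
  *P-cancelˡ {p = p} {q} {r} p-deg pq≃pr with ≃[]⊎hasDegree (q -P r)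
  ... | inj₁ q-r≃[]        = 𝔽[X].x∙y⁻¹≈ε⇒x≈y q r q-r≃[]
  ... | inj₂ (_ , q-r-deg) = contradiction (coef-≈ p[q-r]≃[] _) (proj₂ (hasDegree-*P p-deg q-r-deg))
    where
    p[q-r]≃[] : p *P (q -P r) ≃ []
    p[q-r]≃[] = ≃-trans (𝔽[X].x[y-z]≈xy-xz p q r) (𝔽[X].x≈y⇒x∙y⁻¹≈ε pq≃pr)

  -- Euclidean division and Bézout's identity

  p≃q+[p-q] : ∀ p q → p ≃ q +P (p -P q)
  p≃q+[p-q] p q = ≃-trans (≃-sym (𝔽[X].xyx⁻¹≈y q p)) (+P-assoc q p (-P q))

  p≃q+r⇒r≃p-q : ∀ {p q r} → p ≃ q +P r → r ≃ p -P q
  p≃q+r⇒r≃p-q {p} {q} {r} p≃q+r =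
    ≃-trans (≃-sym (𝔽[X].xyx⁻¹≈y q r)) (+P-cong (≃-sym p≃q+r) ≃-refl)

  cancel-leading : ∀ {m b s} → HasDegree m b → DegreeBelow (suc m) s →
                   ∃ λ a → DegreeBelow m (s -P map (a *_) b)
  cancel-leading {m} {b} {s} (b<1+m , bₘ≉0) s<1+m with inverse (coef b m) bₘ≉0
  ... | bₘ⁻¹ , bₘbₘ⁻¹≈1 =
    a , degreeBelow-pred (degreeBelow-+P s<1+m (degreeBelow--P (degreeBelow-scale a b<1+m))) leading≈0
    where
    open ≈-Reasoning
    a = coef s m * bₘ⁻¹
    abₘ≈sₘ : a * coef b m ≈ coef s m
    abₘ≈sₘ = begin
      (coef s m * bₘ⁻¹) * coef b m  ≈⟨ *-assoc _ _ _ ⟩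
      coef s m * (bₘ⁻¹ * coef b m)  ≈⟨ *-congˡ (trans (*-comm bₘ⁻¹ _) bₘbₘ⁻¹≈1) ⟩
      coef s m * 1#                 ≈⟨ *-identityʳ _ ⟩
      coef s m                      ∎
    leading≈0 : coef (s -P map (a *_) b) m ≈ 0#
    leading≈0 = begin
      coef (s -P map (a *_) b) m            ≈⟨ coef-+P s (-P map (a *_) b) m ⟩
      coef s m + coef (-P map (a *_) b) m   ≈⟨ +-congˡ (coef--P (map (a *_) b) m) ⟩
      coef s m + - coef (map (a *_) b) m    ≈⟨ +-congˡ (-‿cong (trans (coef-scale a b m) abₘ≈sₘ)) ⟩
      coef s m + - coef s m                 ≈⟨ -‿inverseʳ _ ⟩
      0#                                    ∎

  divMod : ∀ {m b} → HasDegree m b → ∀ a → ∃₂ λ q r → a ≃ b *P q +P r × DegreeBelow m r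
  divMod {b = b} _ [] = [] , [] , ≃-sym (≃-trans (+P-identityʳ (b *P [])) (*P-zeroʳ b)) , degreeBelow-[]
  divMod {m} {b} b-deg (a₀ ∷ a) with divMod b-deg a
  ... | q , r , a≃bq+r , r<m with cancel-leading b-deg (degreeBelow-∷ a₀ r<m)
  ... | x , r′<m = (0# ∷ q) +P (x ∷ []) , r′ , a₀∷a≃ , r′<m
    where
    open ≃-Reasoning
    r′ = (a₀ ∷ r) -P map (x *_) b
    b[0∷q]≃0∷bq : b *P (0# ∷ q) ≃ 0# ∷ b *P q
    b[0∷q]≃0∷bq = ≃-trans (*P-∷ʳ b 0# q) (+P-cong (scale-zero b refl) ≃-refl)
    b[x]≃xb : b *P (x ∷ []) ≃ map (x *_) b
    b[x]≃xb = ≃-trans (*P-∷ʳ b x [])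
      (≃-trans (+P-cong ≃-refl (∷-≃[] refl (*P-zeroʳ b))) (+P-identityʳ _))
    a₀∷r≃ : a₀ ∷ r ≃ b *P (x ∷ []) +P r′
    a₀∷r≃ = ≃-trans (p≃q+[p-q] (a₀ ∷ r) (map (x *_) b)) (+P-cong (≃-sym b[x]≃xb) ≃-refl)
    a₀∷a≃ : a₀ ∷ a ≃ b *P ((0# ∷ q) +P (x ∷ [])) +P r′
    a₀∷a≃ = begin
      a₀ ∷ a
        ≈⟨ ∷-cong (sym (+-identityˡ a₀)) a≃bq+r ⟩
      (0# ∷ b *P q) +P (a₀ ∷ r)
        ≈⟨ +P-cong (≃-sym b[0∷q]≃0∷bq) a₀∷r≃ ⟩
      b *P (0# ∷ q) +P (b *P (x ∷ []) +P r′)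
        ≈⟨ +P-assoc (b *P (0# ∷ q)) (b *P (x ∷ [])) r′ ⟨
      b *P (0# ∷ q) +P b *P (x ∷ []) +P r′
        ≈⟨ +P-cong (≃-sym (*P-distribˡ b (0# ∷ q) (x ∷ []))) ≃-refl ⟩
      b *P ((0# ∷ q) +P (x ∷ [])) +P r′
        ∎

  record ExtendedGcd (a b : Pol) : Set (c ⊔ ℓ) where
    field
      gcd s t : Pol
      gcd∣a   : gcd ∣ a
      gcd∣b   : gcd ∣ b
      bezout  : gcd ≃ s *P a +P t *P b

  extendedGcd-[] : ∀ a {b} → b ≃ [] → ExtendedGcd a b
  extendedGcd-[] a b≃[] = record
    { gcd = a ; s = oneP ; t = []
    ; gcd∣a  = oneP , *P-identityˡ a
    ; gcd∣b  = [] , ≃-sym b≃[]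
    ; bezout = ≃-sym (≃-trans (+P-identityʳ (oneP *P a)) (*P-identityˡ a)) }

  extendedGcd-step : ∀ {a b q r} → a ≃ b *P q +P r → ExtendedGcd b r → ExtendedGcd a b
  extendedGcd-step {a} {b} {q} {r} a≃bq+r gcd-b-r = record
    { gcd = gcd ; s = t ; t = s -P t *P q
    ; gcd∣a  = ∣ʳ-respʳ-≈ (≃-sym a≃bq+r)
                 (∣-+P (∣ʳ-respʳ-≈ (*P-comm q b) (x∣ʳy⇒x∣ʳzy q gcd∣a)) gcd∣b)
    ; gcd∣b  = gcd∣a
    ; bezout = ≃-trans bezout bezout′ }
    where
    open ExtendedGcd gcd-b-r
    open ≃-Reasoning
    bezout′ : s *P b +P t *P r ≃ t *P a +P (s -P t *P q) *P b
    bezout′ = begin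
      s *P b +P t *P r
        ≈⟨ +P-cong ≃-refl (*P-congʳ t (p≃q+r⇒r≃p-q a≃bq+r)) ⟩
      s *P b +P t *P (a -P b *P q)
        ≈⟨ +P-cong ≃-refl (𝔽[X].x[y-z]≈xy-xz t a (b *P q)) ⟩
      s *P b +P (t *P a -P t *P (b *P q))
        ≈⟨ +P-leftComm (s *P b) (t *P a) (-P (t *P (b *P q))) ⟩
      t *P a +P (s *P b -P t *P (b *P q))
        ≈⟨ +P-cong (≃-refl {t *P a}) (+P-cong (≃-refl {s *P b}) (-P-cong t[bq]≃[tq]b)) ⟩
      t *P a +P (s *P b -P (t *P q) *P b)
        ≈⟨ +P-cong (≃-refl {t *P a}) (𝔽[X].[y-z]x≈yx-zx b s (t *P q)) ⟨
      t *P a +P (s -P t *P q) *P b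
        ∎
      where
      t[bq]≃[tq]b : t *P (b *P q) ≃ (t *P q) *P b
      t[bq]≃[tq]b = ≃-trans (*P-congʳ t (*P-comm b q)) (≃-sym (*P-assoc t q b))

  hasDegree-< : ∀ {m n p} → HasDegree m p → DegreeBelow n p → m < n
  hasDegree-< {p = p} (_ , pₘ≉0) p<n = ℕ.<-≤-trans (coef≉0⇒<len {p} pₘ≉0) (degreeBelow⇒len≤ p p<n)

  extendedGcd-bounded : ∀ n a b → DegreeBelow n b → ExtendedGcd a b
  extendedGcd-bounded zero    a b b<0   = extendedGcd-[] a (degreeBelow-zero b<0)
  extendedGcd-bounded (suc n) a b b<1+n with ≃[]⊎hasDegree b
  ... | inj₁ b≃[]          = extendedGcd-[] a b≃[]
  ... | inj₂ (m , b-deg) with divMod b-deg a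
  ...   | q , r , a≃bq+r , r<m = extendedGcd-step a≃bq+r
          (extendedGcd-bounded n b r (degreeBelow-mono (ℕ.≤-pred (hasDegree-< b-deg b<1+n)) r<m))

  extendedGcd : ∀ a b → ExtendedGcd a b
  extendedGcd a b = extendedGcd-bounded (len b) a b (degreeBelow-len b)

  coprime⇒bezout : ∀ {a b} → Coprime a b → ∃₂ λ s t → s *P a +P t *P b ≃ oneP
  coprime⇒bezout {a} {b} a⊥b with extendedGcd a b
  ... | record { gcd = g ; s = s ; t = t ; gcd∣a = g∣a ; gcd∣b = g∣b ; bezout = g≃sa+tb }
    with a⊥b g (∣⇒Divides g∣a) (∣⇒Divides g∣b)
  ... | k , gk≈1 = k *P s , k *P t , (begin
    (k *P s) *P a +P (k *P t) *P b  ≈⟨ +P-cong (*P-assoc k s a) (*P-assoc k t b) ⟩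
    k *P (s *P a) +P k *P (t *P b)  ≈⟨ *P-distribˡ k (s *P a) (t *P b) ⟨
    k *P (s *P a +P t *P b)         ≈⟨ *P-congʳ k g≃sa+tb ⟨
    k *P g                          ≈⟨ *P-comm k g ⟩
    g *P k                          ≈⟨ ≈P⇒≃ gk≈1 ⟩
    oneP                            ∎)
    where open ≃-Reasoning

  coprime-∣-cofactor : ∀ {a b c p} → Coprime a b → p ∣ a *P c → p ∣ b → p ∣ c
  coprime-∣-cofactor {a} {b} {c} a⊥b p∣ac p∣b with coprime⇒bezout a⊥b
  ... | s , t , sa+tb≃1 =
    ∣ʳ-respʳ-≈ s[ac]+[tc]b≃c (∣-+P (x∣ʳy⇒x∣ʳzy s p∣ac) (x∣ʳy⇒x∣ʳzy (t *P c) p∣b))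
    where
    open ≃-Reasoning
    s[ac]+[tc]b≃c : s *P (a *P c) +P (t *P c) *P b ≃ c
    s[ac]+[tc]b≃c = begin
      s *P (a *P c) +P (t *P c) *P b   ≈⟨ +P-cong (*P-assoc s a c) [tc]b≃[tb]c ⟨
      (s *P a) *P c +P (t *P b) *P c   ≈⟨ *P-distribʳ c (s *P a) (t *P b) ⟨
      (s *P a +P t *P b) *P c          ≈⟨ *P-congˡ c sa+tb≃1 ⟩
      oneP *P c                        ≈⟨ *P-identityˡ c ⟩
      c                                ∎
      where
      [tc]b≃[tb]c : (t *P b) *P c ≃ (t *P c) *P b
      [tc]b≃[tb]c = ≃-trans (*P-assoc t b c) (≃-trans (*P-congʳ t (*P-comm b c)) (≃-sym (*P-assoc t c b)))

  -- The pair [f², h f]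

  [ff]x≃[xf]f : ∀ f x → f *P f *P x ≃ x *P f *P f
  [ff]x≃[xf]f f x = ≃-trans (*P-comm (f *P f) x) (≃-sym (*P-assoc x f f))

  [ff][hh]≃[hf][hf] : ∀ f h → f *P f *P (h *P h) ≃ h *P f *P (h *P f)
  [ff][hh]≃[hf][hf] f h = ≃-trans (*P-interchange f f h h) (𝔽[X].*-cong (*P-comm f h) (*P-comm f h))

  f²[x-h²]≃xf²-[hf]² : ∀ x f h → f *P f *P (x -P h *P h) ≃ x *P f *P f -P h *P f *P (h *P f)
  f²[x-h²]≃xf²-[hf]² x f h = ≃-trans (𝔽[X].x[y-z]≈xy-xz (f *P f) x (h *P h))
    (+P-cong ([ff]x≃[xf]f f x) (-P-cong ([ff][hh]≃[hf][hf] f h)))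

  f²[h²-x]≃[hf]²-xf² : ∀ x f h → f *P f *P (h *P h -P x) ≃ h *P f *P (h *P f) -P x *P f *P f
  f²[h²-x]≃[hf]²-xf² x f h = ≃-trans (𝔽[X].x[y-z]≈xy-xz (f *P f) (h *P h) x)
    (+P-cong ([ff][hh]≃[hf][hf] f h) (-P-cong ([ff]x≃[xf]f f x)))

  len-[hf]<len-[ff] : ∀ {d f h} → HasDegree d f → DegreeBelow d h → len (h *P f) < len (f *P f)
  len-[hf]<len-[ff] {f = f} {h} f-deg h<d = ℕ.≤-<-trans
    (degreeBelow⇒len≤ (h *P f) (degreeBelow-*P h<d (proj₁ f-deg)))
    (coef≉0⇒<len {f *P f} (proj₂ (hasDegree-*P f-deg f-deg)))

lemma1 : {c ℓ : Level} (𝔽 : FiniteField c ℓ) →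
    let open FiniteField 𝔽
        open Poly 𝔽
    in
    ¬ (1# + 1# ≈ 0#) →
    (d : ℕ) (f : Pol) → Irreducible f → len f ≡ suc d →
    (h : Pol) → len h ≤ d →
    Coprime f (X -P h *P h) →
    MumfordRep (X *P f *P f) (f *P f) (h *P f)
lemma1 𝔽 _ d f _ len-f h len-h f⊥x-h² =
    len-[hf]<len-[ff] f-degree (len≤⇒degreeBelow h len-h)
  , (h *P h -P X , ≃⇒≈P (f²[h²-x]≃[hf]²-xf² X f h))
  , multiplicity-condition
  where
  open FiniteField 𝔽
  open Poly 𝔽
  open PolynomialArithmetic 𝔽

  f-degree : HasDegree d f
  f-degree = len≡suc⇒hasDegree len-f

  multiplicity-condition : ∀ w → f *P f *P w ≈P X *P f *P f -P h *P f *P (h *P f) →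
                           ∀ P → Irreducible P → Divides (P *P P) (X *P f *P f) →
                           Divides P (f *P f) → Divides P (h *P f) → ¬ Divides P w
  multiplicity-condition w f²w≈xf²-[hf]² P (_ , P-nonunit , _) _ P∣f² _ P∣w =
    P-nonunit (f⊥x-h² P (∣⇒Divides P∣f) (∣⇒Divides P∣x-h²))
    where
    w≃x-h² : w ≃ X -P h *P h
    w≃x-h² = *P-cancelˡ (hasDegree-*P f-degree f-degree)
      (≃-trans (≈P⇒≃ f²w≈xf²-[hf]²) (≃-sym (f²[x-h²]≃xf²-[hf]² X f h)))
    P∣x-h² : P ∣ X -P h *P h
    P∣x-h² = ∣ʳ-respʳ-≈ w≃x-h² (Divides⇒∣ P∣w)
    P∣f : P ∣ f
    P∣f = coprime-∣-cofactor f⊥x-h² (Divides⇒∣ P∣f²) P∣x-h²
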